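{- Let $k\ge 1$ and let $(C_{2k+1},\sigma)$ be a signed odd cycle $v_1v_2\cdots v_{2k+1}$ with a list assignment $L$ satisfying one of the following: (1) $L(v_i)$ is a neighbored $5$-set for each even $i$ and a paired $10$-set for each odd $i$; (2) $L(v_1)=C$, $L(v_{2k+1})$ is a neighbored $5$-set, and for every other $i$, $L(v_i)$ is a neighbored $5$-set if $i$ is even and a paired $10$-set if $i$ is odd. Then $(C_{2k+1},\sigma)$ is $L$-colorable.
   Context: A signed cycle carries a signature $\sigma:E\to\{+,-\}$. Let $C=\{i^+,i^-:1\le i\le 6\}$ be the vertex set of ${\rm DSG}(K_6,M)$ with signature $m^*$: for $i\ne j$ and $\alpha\in\{+,-\}$, $i^\alpha j^\alpha$ is an edge, negative if $\{i,j\}\in\{\{1,2\},\{3,4\},\{5,6\}\}$ and positive otherwise; $i^\alpha j^{ -\alpha}$ is an edge, positive if $\{i,j\}\in\{\{1,2\},\{3,4\},\{5,6\}\}$ and negative otherwise; $i^+,i^-$ are non-adjacent. $C^+=\{i^+\}$, $C^-=\{i^-\}$. The pair of $(2l-1)^\alpha$ is $(2l)^\alpha$ and vice versa; a layer is $\{(2l-1)^+,(2l)^+,(2l-1)^-,(2l)^-\}$, $l=1,2,3$. A set $L\subseteq C$ is paired if all but at most one of its elements have their pair in $L$; a paired $n$-set is a paired set of size $n$. A neighbored $5$-set is a set of size $5$, no three elements in a common layer, consisting of two pairs contained in one of $C^+,C^-$ and one element of the other. An $L$-coloring is a map $\phi$ with $\phi(v)\in L(v)$ such that each edge $uv$ maps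 to an edge $\phi(u)\phi(v)$ of ${\rm DSG}(K_6,M)$ with $m^*(\phi(u)\phi(v))=\sigma(uv)$. -}

module Defs where

open import Data.Nat using (ℕ; zero; suc; _+_; _*_; _≤_; _<_; _/_; _%_; _≡ᵇ_)
open import Data.Nat.DivMod using (_mod_)
open import Data.Bool using (Bool; true; false; not; _∧_; _∨_; _xor_; if_then_else_)
open import Data.Fin using (Fin; zero; suc; toℕ; fromℕ)
open import Data.List using (List; _∷_; []; map; allFin; cartesianProduct)
open import Data.Nat.ListAction using (sum)
open import Data.Product using (_×_; _,_; proj₁; proj₂; Σ; ∃-syntax)
open import Data.Sum using (_⊎_)
open import Relation.Binary.PropositionalEquality using (_≡_; _≢_)
open import Function.Bundles using (_⇔_)

-- Vertices of DSG(K_6, M): C = { i^α }.  (i , α) with i : Fin 6 standing for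
-- the paper's label toℕ i + 1, and α = true for "+", false for "-".
C : Set
C = Fin 6 × Bool

idx : C → Fin 6
idx = proj₁

sgn : C → Bool
sgn = proj₂

-- Layer of a vertex: 0,1,2 for paper layers {1,2},{3,4},{5,6}.
layer : C → ℕ
layer c = toℕ (idx c) / 2

-- the "pair" partner: (2l-1)^α <-> (2l)^α
partner : Fin 6 → Fin 6
partner zero = suc zero
partner (suc zero) = zero
partner (suc (suc zero)) = suc (suc (suc zero))
partner (suc (suc (suc zero))) = suc (suc zero)
partner (suc (suc (suc (suc zero)))) = suc (suc (suc (suc (suc zero))))
partner (suc (suc (suc (suc (suc zero))))) = suc (suc (suc (suc zero)))

pair : C → C
pair (i , α) = (partner i , α)

Adjacent : C → C → Set
Adjacent u v = idx u ≢ idx v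

sameB : Bool → Bool → Bool
sameB true b = b
sameB false b = not b

-- Signature m* (true = positive).  {i,j} ∈ M iff i ≠ j lie in the same layer.
-- same sign α=β: negative iff {i,j} ∈ M ; opposite signs: positive iff {i,j} ∈ M.
mstar : C → C → Bool
mstar u v = sameB (sgn u) (sgn v) xor (layer u ≡ᵇ layer v)

allC : List C
allC = cartesianProduct (allFin 6) (true ∷ false ∷ [])

SubC : Set
SubC = C → Bool

_∈ˢ_ : C → SubC → Set
c ∈ˢ L = L c ≡ true

card : SubC → ℕ
card L = sum (map (λ c → if L c then 1 else 0) allC)

Paired : SubC → Set
Paired L = card (λ c → L c ∧ not (L (pair c))) ≤ 1

PairedSetOfSize : ℕ → SubC → Set
PairedSetOfSize n L = Paired L × card L ≡ n

NoThreeInLayer : SubC → Set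
NoThreeInLayer L = ∀ (l : ℕ) → card (λ c → L c ∧ (layer c ≡ᵇ l)) ≤ 2

Neighbored5 : SubC → Set
Neighbored5 L =
  card L ≡ 5 × NoThreeInLayer L ×
  (∃[ s ] ∃[ l₁ ] ∃[ l₂ ] ∃[ x ]
     ((l₁ ≢ l₂) ×
      (∀ c → (c ∈ˢ L) ⇔
         ((sgn c ≡ s × (layer c ≡ toℕ {3} l₁ ⊎ layer c ≡ toℕ {3} l₂))
          ⊎ c ≡ (x , not s)))))

-- The odd cycle C_{2k+1}: vertices v_1 … v_{2k+1} represented by Fin (2k+1),
-- where i : Fin (2k+1) is v_{pos i} with pos i = toℕ i + 1.
Cyc : ℕ → Set
Cyc k = Fin (suc (2 * k))

pos : (k : ℕ) → Cyc k → ℕ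
pos k i = suc (toℕ i)

next : (k : ℕ) → Cyc k → Cyc k
next k i = suc (toℕ i) mod suc (2 * k)

first : (k : ℕ) → Cyc k
first k = zero

lastV : (k : ℕ) → Cyc k
lastV k = fromℕ (2 * k)

-- A signature σ assigns to the edge v_{pos i} v_{pos (next k i)} the sign σ i
-- (true = positive).  A list assignment assigns a subset of C to each vertex.
Signature : ℕ → Set
Signature k = Cyc k → Bool

ListAssignment : ℕ → Set
ListAssignment k = Cyc k → SubC

IsLColoring : (k : ℕ) → Signature k → ListAssignment k → (Cyc k → C) → Set
IsLColoring k σ L φ =
  (∀ i → φ i ∈ˢ L i) ×
  (∀ i → Adjacent (φ i) (φ (next k i)) × mstar (φ i) (φ (next k i)) ≡ σ i)

LColorable : (k : ℕ) → Signature k → ListAssignment k → Set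
LColorable k σ L = Σ (Cyc k → C) (IsLColoring k σ L)

EvenN : ℕ → Set
EvenN n = n % 2 ≡ 0

OddN : ℕ → Set
OddN n = n % 2 ≡ 1

Cond1 : (k : ℕ) → ListAssignment k → Set
Cond1 k L = ∀ (i : Cyc k) →
  (EvenN (pos k i) → Neighbored5 (L i)) × (OddN (pos k i) → PairedSetOfSize 10 (L i))

Cond2 : (k : ℕ) → ListAssignment k → Set
Cond2 k L =
  (∀ c → c ∈ˢ L (first k)) ×
  Neighbored5 (L (lastV k)) ×
  (∀ (i : Cyc k) → 1 < pos k i → pos k i < suc (2 * k) →
     (EvenN (pos k i) → Neighbored5 (L i)) × (OddN (pos k i) → PairedSetOfSize 10 (L i)))

-- A paired 10-set contains C minus one pair and a neighbored 5-set contains one of the sets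
-- neighbored s x, so it suffices to colour from these canonical lists; every local fact about them
-- below is decided by enumerating the twelve colours.
--
-- Through a paired vertex every colour of the next neighbored vertex is reached from some colour
-- of the previous one, so walking down the path from vertex 2k - 1 to vertex 3 (counting from 0)
-- any colour e of vertex 2k - 1 is the end of a proper colouring.  The cycle is therefore closed
-- by fixing the colours d of vertex 2k and e of vertex 2k - 1 first, with d chosen so that
-- whatever colour f vertex 3 receives, d and f are joined through vertices 0, 1 and 2: the list of
-- vertex 1 splits into a pair and the rest, one of which is always bridged to f through vertex 2,
-- while every colour outside at most two pairs (one pair if vertex 0 may take any colour) reaches
-- both parts through vertex 0.  Triangles are checked directly.

module Submission where

open import Defs
open import Data.Bool using (Bool; true; false; not; _∧_; _∨_; if_then_else_)
import Data.Bool.Properties as Boolₚ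
open import Data.Empty using (⊥-elim)
open import Data.Fin using (Fin; toℕ)
import Data.Fin.Properties as Finₚ
open import Data.Fin.Subset using (Subset)
open import Data.Fin.Subset.Properties using (anySubset?)
open import Data.List using (map)
open import Data.List.Properties using (map-cong)
open import Data.Nat using (ℕ; zero; suc; _+_; _*_; _≤_; _<_; _%_; _≡ᵇ_; _≤?_; z≤n; s≤s)
import Data.Nat.Properties as ℕₚ
open import Data.Nat.DivMod using (_mod_; m<n⇒m%n≡m; n%n≡0; m*n%n≡0; [m+kn]%n≡m%n)
open import Data.Nat.ListAction using (sum)
open import Data.Product using (_×_; _,_; proj₁; proj₂; ∃; ∃₂; ∃-syntax)
open import Data.Product.Properties using (≡-dec)
open import Data.Sum using (_⊎_; inj₁; inj₂)
open import Data.Vec using (lookup; tabulate)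
open import Data.Vec.Properties using (lookup∘tabulate)
open import Function.Bundles using (_⇔_; Equivalence)
open import Relation.Binary using (tri<; tri≈; tri>)
open import Relation.Binary.PropositionalEquality
  using (_≡_; _≢_; refl; sym; trans; cong; cong₂; subst; subst₂)
open import Relation.Nullary using (Dec; yes; no; does; ¬_; ¬?)
open import Relation.Nullary.Decidable
  using (_×-dec_; _⊎-dec_; _→-dec_; from-yes; map′; decidable-stable; ⌊_⌋; dec-true; dec-false)

-- Deciding statements about colours

∀Bool? : {P : Bool → Set} → (∀ b → Dec (P b)) → Dec (∀ b → P b)
∀Bool? P? = map′ (λ { (t , f) true → t ; (t , f) false → f }) (λ h → h true , h false)
  (P? true ×-dec P? false)

∃Bool? : {P : Bool → Set} → (∀ b → Dec (P b)) → Dec (∃ P)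
∃Bool? P? = map′ (λ { (inj₁ t) → true , t ; (inj₂ f) → false , f })
  (λ { (true , t) → inj₁ t ; (false , f) → inj₂ f }) (P? true ⊎-dec P? false)

∀C? : {P : C → Set} → (∀ c → Dec (P c)) → Dec (∀ c → P c)
∀C? P? = map′ (λ h (i , α) → h i α) (λ h i α → h (i , α)) (Finₚ.all? λ i → ∀Bool? λ α → P? (i , α))

∃C? : {P : C → Set} → (∀ c → Dec (P c)) → Dec (∃ P)
∃C? P? = map′ (λ (i , α , p) → (i , α) , p) (λ ((i , α) , p) → i , α , p)
  (Finₚ.any? λ i → ∃Bool? λ α → P? (i , α))

∀Subset? : ∀ {n} {P : Subset n → Set} → (∀ p → Dec (P p)) → Dec (∀ p → P p)
∀Subset? P? = map′ (λ ∄¬P p → decidable-stable (P? p) (λ ¬Pp → ∄¬P (p , ¬Pp)))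
  (λ ∀P (p , ¬Pp) → ¬Pp (∀P p)) (¬? (anySubset? λ p → ¬? (P? p)))

_∈?_ : ∀ c L → Dec (c ∈ˢ L)
c ∈? L = L c Boolₚ.≟ true

_∉ˢ_ : C → SubC → Set
c ∉ˢ L = ¬ (c ∈ˢ L)

_⊆ˢ_ : SubC → SubC → Set
A ⊆ˢ B = ∀ c → c ∈ˢ A → c ∈ˢ B

_⊆?_ : ∀ A B → Dec (A ⊆ˢ B)
A ⊆? B = ∀C? λ c → (c ∈? A) →-dec (c ∈? B)

-- A record rather than a product, so that unification can recover the two colours.
record Edge (σ : Bool) (u v : C) : Set where
  constructor edge
  field
    adjacent : Adjacent u v
    signed : mstar u v ≡ σ

edge? : ∀ σ u v → Dec (Edge σ u v)
edge? σ u v = map′ (λ (a , s) → edge a s) (λ (edge a s) → a , s)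
  (¬? (idx u Finₚ.≟ idx v) ×-dec (mstar u v Boolₚ.≟ σ))

fromSubsets : Subset 6 → Subset 6 → SubC
fromSubsets p⁺ p⁻ (i , true) = lookup p⁺ i
fromSubsets p⁺ p⁻ (i , false) = lookup p⁻ i

-- A predicate stored as a table: the decision procedures below then evaluate it once per
-- colour instead of once per use.
tabulated : SubC → SubC
tabulated L = fromSubsets (tabulate λ i → L (i , true)) (tabulate λ i → L (i , false))

tabulated-≗ : ∀ L c → tabulated L c ≡ L c
tabulated-≗ L (i , true) = lookup∘tabulate (λ j → L (j , true)) i
tabulated-≗ L (i , false) = lookup∘tabulate (λ j → L (j , false)) i

∈-tabulated-does : ∀ {P : C → Set} (P? : ∀ c → Dec (P c)) {c} → c ∈ˢ tabulated (λ d → does (P? d)) → P c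
∈-tabulated-does P? {c} c∈ with P? c | trans (sym (tabulated-≗ (λ d → does (P? d)) c)) c∈
... | yes p | _ = p
... | no _ | ()

≗-does : ∀ {L} {P : C → Set} (P? : ∀ c → Dec (P c)) → (∀ c → (c ∈ˢ L) ⇔ P c) → ∀ c → L c ≡ does (P? c)
≗-does {L} P? L⇔P c with L c in eq | P? c
... | true  | yes _ = refl
... | true  | no ¬p = ⊥-elim (¬p (Equivalence.to (L⇔P c) eq))
... | false | yes p = trans (sym eq) (Equivalence.from (L⇔P c) p)
... | false | no _ = refl

card-cong : ∀ {A B : SubC} → (∀ c → A c ≡ B c) → card A ≡ card B
card-cong A≗B = cong sum (map-cong (λ c → cong (if_then 1 else 0) (A≗B c)) allC)

-- The two kinds of lists

Pair : Set
Pair = Fin 3 × Bool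

∀Pair? : {P : Pair → Set} → (∀ p → Dec (P p)) → Dec (∀ p → P p)
∀Pair? P? = map′ (λ h (l , α) → h l α) (λ h l α → h (l , α)) (Finₚ.all? λ l → ∀Bool? λ α → P? (l , α))

∃Pair? : {P : Pair → Set} → (∀ p → Dec (P p)) → Dec (∃ P)
∃Pair? P? = map′ (λ (l , α , p) → (l , α) , p) (λ ((l , α) , p) → l , α , p)
  (Finₚ.any? λ l → ∃Bool? λ α → P? (l , α))

-- (l , α) is the pair {(2l+1)^α , (2l+2)^α} of the paper, the layers counted from 0.
pairSet : Pair → SubC
pairSet (l , α) c = (layer c ≡ᵇ toℕ l) ∧ sameB (sgn c) α

allBut : Pair → SubC
allBut p c = not (pairSet p c)

full : SubC
full _ = true

neighbored : Bool → Fin 6 → SubC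
neighbored s x c =
  (sameB (sgn c) s ∧ not (layer c ≡ᵇ layer (x , s))) ∨ (⌊ idx c Finₚ.≟ x ⌋ ∧ sameB (sgn c) (not s))

ContainsAllBut : SubC → Set
ContainsAllBut L = ∃[ q ] allBut q ⊆ˢ L

ContainsNeighbored : SubC → Set
ContainsNeighbored L = ∃₂ λ s x → neighbored s x ⊆ˢ L

pairedSetOfSize-cong : ∀ {n A B} → (∀ c → A c ≡ B c) → PairedSetOfSize n A → PairedSetOfSize n B
pairedSetOfSize-cong A≗B (paired , size) =
  subst (_≤ 1) (card-cong λ c → cong₂ (λ a b → a ∧ not b) (A≗B c) (A≗B (pair c))) paired ,
  trans (sym (card-cong A≗B)) size

-- Decided facts are opaque: otherwise using them may unfold the enumeration.
opaque
  paired10-of-subsets : ∀ p⁺ p⁻ → card (fromSubsets p⁺ p⁻) ≡ 10 → Paired (fromSubsets p⁺ p⁻) →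
    ContainsAllBut (fromSubsets p⁺ p⁻)
  paired10-of-subsets = from-yes
    (∀Subset? λ p⁺ → ∀Subset? λ p⁻ → let L = fromSubsets p⁺ p⁻ in
     (card L ℕₚ.≟ 10) →-dec (card (λ c → L c ∧ not (L (pair c))) ≤? 1) →-dec
     ∃Pair? λ q → allBut q ⊆? L)

paired10-contains-allBut : ∀ {L} → PairedSetOfSize 10 L → ContainsAllBut L
paired10-contains-allBut {L} paired10 =
  let (paired , size) = pairedSetOfSize-cong (λ c → sym (tabulated-≗ L c)) paired10
      (q , allBut⊆) = paired10-of-subsets (tabulate λ i → L (i , true)) (tabulate λ i → L (i , false)) size paired
  in q , λ c c∈ → trans (sym (tabulated-≗ L c)) (allBut⊆ c c∈)

Described : Bool → Fin 3 → Fin 3 → Fin 6 → C → Set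
Described s l₁ l₂ x c = (sgn c ≡ s × (layer c ≡ toℕ l₁ ⊎ layer c ≡ toℕ l₂)) ⊎ c ≡ (x , not s)

described? : ∀ s l₁ l₂ x c → Dec (Described s l₁ l₂ x c)
described? s l₁ l₂ x c =
  ((sgn c Boolₚ.≟ s) ×-dec ((layer c ℕₚ.≟ toℕ l₁) ⊎-dec (layer c ℕₚ.≟ toℕ l₂))) ⊎-dec
  ≡-dec Finₚ._≟_ Boolₚ._≟_ c (x , not s)

description : Bool → Fin 3 → Fin 3 → Fin 6 → SubC
description s l₁ l₂ x c = does (described? s l₁ l₂ x c)

AtMostTwoIn : Fin 3 → SubC → Set
AtMostTwoIn l L = card (λ c → L c ∧ (layer c ≡ᵇ toℕ l)) ≤ 2

-- If x lay in layer l₁ or l₂, that layer would contain three elements of the description.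
opaque
  description-neighbored : ∀ s l₁ l₂ x → l₁ ≢ l₂ →
    AtMostTwoIn l₁ (description s l₁ l₂ x) → AtMostTwoIn l₂ (description s l₁ l₂ x) →
    neighbored s x ⊆ˢ description s l₁ l₂ x
  description-neighbored = from-yes
    (∀Bool? λ s → Finₚ.all? λ l₁ → Finₚ.all? λ l₂ → Finₚ.all? λ x → let D = description s l₁ l₂ x in
     ¬? (l₁ Finₚ.≟ l₂) →-dec (card (λ c → D c ∧ (layer c ≡ᵇ toℕ l₁)) ≤? 2) →-dec
     (card (λ c → D c ∧ (layer c ≡ᵇ toℕ l₂)) ≤? 2) →-dec (neighbored s x ⊆? D))

neighbored5-contains-neighbored : ∀ {L} → Neighbored5 L → ContainsNeighbored L
neighbored5-contains-neighbored {L} (_ , noThree , s , l₁ , l₂ , x , l₁≢l₂ , L⇔) =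
  s , x , λ c c∈ → trans (L≗ c) (description-neighbored s l₁ l₂ x l₁≢l₂ (atMostTwo l₁) (atMostTwo l₂) c c∈)
  where
  L≗ : ∀ c → L c ≡ description s l₁ l₂ x c
  L≗ = ≗-does (described? s l₁ l₂ x) L⇔
  atMostTwo : ∀ l → AtMostTwoIn l (description s l₁ l₂ x)
  atMostTwo l = subst (_≤ 2) (card-cong λ c → cong (_∧ (layer c ≡ᵇ toℕ l)) (L≗ c)) (noThree (toℕ l))

-- Local colouring facts

HasEdgeFrom : SubC → Bool → C → Set
HasEdgeFrom N σ d = ∃[ e ] e ∈ˢ N × Edge σ e d

hasEdgeFrom? : ∀ N σ d → Dec (HasEdgeFrom N σ d)
hasEdgeFrom? N σ d = ∃C? λ e → (e ∈? N) ×-dec edge? σ e d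

opaque
  reached-from-neighbored : ∀ e q s x σ σ′ →
    ∃[ d ] d ∈ˢ allBut q × Edge σ d e × HasEdgeFrom (neighbored s x) σ′ d
  reached-from-neighbored = from-yes
    (∀C? λ e → ∀Pair? λ q → ∀Bool? λ s → Finₚ.all? λ x → ∀Bool? λ σ → ∀Bool? λ σ′ →
     ∃C? λ d → (d ∈? allBut q) ×-dec edge? σ d e ×-dec hasEdgeFrom? (neighbored s x) σ′ d)

Bridge : Pair → Bool → Bool → C → C → Set
Bridge q σ σ′ b f = ∃[ c ] c ∈ˢ allBut q × Edge σ b c × Edge σ′ c f

bridge? : ∀ q σ σ′ b f → Dec (Bridge q σ σ′ b f)
bridge? q σ σ′ b f = ∃C? λ c → (c ∈? allBut q) ×-dec edge? σ b c ×-dec edge? σ′ c f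

BridgedPart : Bool → Fin 6 → Fin 3 → Pair → Bool → Bool → C → Set
BridgedPart s x l q σ σ′ f =
  (∀ b → b ∈ˢ pairSet (l , s) → Bridge q σ σ′ b f) ⊎
  (∀ b → b ∈ˢ neighbored s x → b ∉ˢ pairSet (l , s) → Bridge q σ σ′ b f)

opaque
  some-part-always-bridged : ∀ s x q σ σ′ →
    ∃[ l ] pairSet (l , s) ⊆ˢ neighbored s x × ∀ f → BridgedPart s x l q σ σ′ f
  some-part-always-bridged = from-yes
    (∀Bool? λ s → Finₚ.all? λ x → ∀Pair? λ q → ∀Bool? λ σ → ∀Bool? λ σ′ →
     Finₚ.any? λ l → (pairSet (l , s) ⊆? neighbored s x) ×-dec ∀C? λ f →
       (∀C? λ b → (b ∈? pairSet (l , s)) →-dec bridge? q σ σ′ b f) ⊎-dec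
       (∀C? λ b → (b ∈? neighbored s x) →-dec ¬? (b ∈? pairSet (l , s)) →-dec bridge? q σ σ′ b f))

Reach : SubC → Bool → Bool → C → C → Set
Reach A σ σ′ d b = ∃[ a ] a ∈ˢ A × Edge σ′ d a × Edge σ a b

reach? : ∀ A σ σ′ d b → Dec (Reach A σ σ′ d b)
reach? A σ σ′ d b = ∃C? λ a → (a ∈? A) ×-dec edge? σ′ d a ×-dec edge? σ a b

ReachesBothParts : SubC → Bool → Fin 6 → Fin 3 → Bool → Bool → C → Set
ReachesBothParts A s x l σ σ′ d =
  (∃[ b ] b ∈ˢ pairSet (l , s) × Reach A σ σ′ d b) ×
  (∃[ b ] b ∈ˢ neighbored s x × b ∉ˢ pairSet (l , s) × Reach A σ σ′ d b)

reachesBothParts? : ∀ A s x l σ σ′ d → Dec (ReachesBothParts A s x l σ σ′ d)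
reachesBothParts? A s x l σ σ′ d =
  (∃C? λ b → (b ∈? pairSet (l , s)) ×-dec reach? A σ σ′ d b) ×-dec
  (∃C? λ b → (b ∈? neighbored s x) ×-dec ¬? (b ∈? pairSet (l , s)) ×-dec reach? A σ σ′ d b)

AllButTwoPairs : SubC → Set
AllButTwoPairs G = ∃₂ λ q₁ q₂ → ∀ d → d ∉ˢ pairSet q₁ → d ∉ˢ pairSet q₂ → d ∈ˢ G

AllButOnePair : SubC → Set
AllButOnePair G = ∃[ q ] ∀ d → d ∉ˢ pairSet q → d ∈ˢ G

opaque
  reaching-both-parts-from-allBut : ∀ s x l q σ σ′ → pairSet (l , s) ⊆ˢ neighbored s x →
    AllButTwoPairs (tabulated λ d → does (reachesBothParts? (allBut q) s x l σ σ′ d))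
  reaching-both-parts-from-allBut = from-yes
    (∀Bool? λ s → Finₚ.all? λ x → Finₚ.all? λ l → ∀Pair? λ q → ∀Bool? λ σ → ∀Bool? λ σ′ →
     let G = tabulated λ d → does (reachesBothParts? (allBut q) s x l σ σ′ d) in
     (pairSet (l , s) ⊆? neighbored s x) →-dec
     ∃Pair? λ q₁ → ∃Pair? λ q₂ → ∀C? λ d → ¬? (d ∈? pairSet q₁) →-dec ¬? (d ∈? pairSet q₂) →-dec (d ∈? G))

opaque
  reaching-both-parts-from-full : ∀ s x l σ σ′ → pairSet (l , s) ⊆ˢ neighbored s x →
    AllButOnePair (tabulated λ d → does (reachesBothParts? full s x l σ σ′ d))
  reaching-both-parts-from-full = from-yes
    (∀Bool? λ s → Finₚ.all? λ x → Finₚ.all? λ l → ∀Bool? λ σ → ∀Bool? λ σ′ →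
     let G = tabulated λ d → does (reachesBothParts? full s x l σ σ′ d) in
     (pairSet (l , s) ⊆? neighbored s x) →-dec
     ∃Pair? λ q → ∀C? λ d → ¬? (d ∈? pairSet q) →-dec (d ∈? G))

opaque
  allBut-avoiding-two-pairs : ∀ q₁ q₂ q s x σ →
    ∃[ d ] d ∈ˢ allBut q × d ∉ˢ pairSet q₁ × d ∉ˢ pairSet q₂ × HasEdgeFrom (neighbored s x) σ d
  allBut-avoiding-two-pairs = from-yes
    (∀Pair? λ q₁ → ∀Pair? λ q₂ → ∀Pair? λ q → ∀Bool? λ s → Finₚ.all? λ x → ∀Bool? λ σ →
     ∃C? λ d → (d ∈? allBut q) ×-dec ¬? (d ∈? pairSet q₁) ×-dec ¬? (d ∈? pairSet q₂) ×-dec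
       hasEdgeFrom? (neighbored s x) σ d)

opaque
  neighbored-avoiding-a-pair : ∀ q s′ x′ s x σ →
    ∃[ d ] d ∈ˢ neighbored s′ x′ × d ∉ˢ pairSet q × HasEdgeFrom (neighbored s x) σ d
  neighbored-avoiding-a-pair = from-yes
    (∀Pair? λ q → ∀Bool? λ s′ → Finₚ.all? λ x′ → ∀Bool? λ s → Finₚ.all? λ x → ∀Bool? λ σ →
     ∃C? λ d → (d ∈? neighbored s′ x′) ×-dec ¬? (d ∈? pairSet q) ×-dec hasEdgeFrom? (neighbored s x) σ d)

Triangle : SubC → SubC → SubC → Bool → Bool → Bool → Set
Triangle A B D σ₀ σ₁ σ₂ =
  ∃[ a ] a ∈ˢ A × ∃[ b ] b ∈ˢ B × Edge σ₀ a b × ∃[ c ] c ∈ˢ D × Edge σ₁ b c × Edge σ₂ c a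

triangle? : ∀ A B D σ₀ σ₁ σ₂ → Dec (Triangle A B D σ₀ σ₁ σ₂)
triangle? A B D σ₀ σ₁ σ₂ =
  ∃C? λ a → (a ∈? A) ×-dec ∃C? λ b → (b ∈? B) ×-dec edge? σ₀ a b ×-dec
  ∃C? λ c → (c ∈? D) ×-dec edge? σ₁ b c ×-dec edge? σ₂ c a

opaque
  triangle-allBut : ∀ q₀ s x q₂ σ₀ σ₁ σ₂ → Triangle (allBut q₀) (neighbored s x) (allBut q₂) σ₀ σ₁ σ₂
  triangle-allBut = from-yes
    (∀Pair? λ q₀ → ∀Bool? λ s → Finₚ.all? λ x → ∀Pair? λ q₂ → ∀Bool? λ σ₀ → ∀Bool? λ σ₁ → ∀Bool? λ σ₂ →
     triangle? (allBut q₀) (neighbored s x) (allBut q₂) σ₀ σ₁ σ₂)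

opaque
  triangle-full : ∀ s x s′ x′ σ₀ σ₁ σ₂ → Triangle full (neighbored s x) (neighbored s′ x′) σ₀ σ₁ σ₂
  triangle-full = from-yes
    (∀Bool? λ s → Finₚ.all? λ x → ∀Bool? λ s′ → Finₚ.all? λ x′ → ∀Bool? λ σ₀ → ∀Bool? λ σ₁ → ∀Bool? λ σ₂ →
     triangle? full (neighbored s x) (neighbored s′ x′) σ₀ σ₁ σ₂)

-- Colourings of consecutive vertices

glue : ℕ → (ℕ → C) → (ℕ → C) → ℕ → C
glue j ψ₁ ψ₂ t = if does (t ≤? j) then ψ₁ t else ψ₂ t

glue-≤ : ∀ {j ψ₁ ψ₂ t} → t ≤ j → glue j ψ₁ ψ₂ t ≡ ψ₁ t
glue-≤ {j} {t = t} t≤j rewrite dec-true (t ≤? j) t≤j = refl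

glue-> : ∀ {j ψ₁ ψ₂ t} → j < t → glue j ψ₁ ψ₂ t ≡ ψ₂ t
glue-> {j} {t = t} j<t rewrite dec-false (t ≤? j) (ℕₚ.<⇒≱ j<t) = refl

glue-top : ∀ j ψ c → glue j ψ (λ _ → c) (suc j) ≡ c
glue-top j ψ c = glue-> {j} {ψ} {λ _ → c} ℕₚ.≤-refl

triple : C → C → C → ℕ → C
triple a b c zero = a
triple a b c (suc zero) = b
triple a b c (suc (suc _)) = c

module Walks (Λ : ℕ → SubC) (σ : ℕ → Bool) where

  record ProperOn (i j : ℕ) (ψ : ℕ → C) : Set where
    field
      coloured : ∀ {t} → i ≤ t → t ≤ j → ψ t ∈ˢ Λ t
      joined : ∀ {t} → i ≤ t → t < j → Edge (σ t) (ψ t) (ψ (suc t))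
  open ProperOn

  single : ∀ {i c} → c ∈ˢ Λ i → ProperOn i i (λ _ → c)
  single {c = c} c∈ .coloured i≤t t≤i = subst (λ t → c ∈ˢ Λ t) (ℕₚ.≤-antisym i≤t t≤i) c∈
  single c∈ .joined i≤t t<i = ⊥-elim (ℕₚ.<⇒≱ t<i i≤t)

  glue-proper : ∀ {i j n ψ₁ ψ₂} → ProperOn i j ψ₁ → ProperOn (suc j) n ψ₂ →
    Edge (σ j) (ψ₁ j) (ψ₂ (suc j)) → ProperOn i n (glue j ψ₁ ψ₂)
  glue-proper {i} {j} {n} {ψ₁} {ψ₂} P₁ P₂ link = record { coloured = coloured′ ; joined = joined′ }
    where
    left : ∀ {t} → t ≤ j → glue j ψ₁ ψ₂ t ≡ ψ₁ t
    left = glue-≤ {j} {ψ₁} {ψ₂}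
    right : ∀ {t} → j < t → glue j ψ₁ ψ₂ t ≡ ψ₂ t
    right = glue-> {j} {ψ₁} {ψ₂}
    coloured′ : ∀ {t} → i ≤ t → t ≤ n → glue j ψ₁ ψ₂ t ∈ˢ Λ t
    coloured′ {t} i≤t t≤n with t ≤? j
    ... | yes t≤j = subst (_∈ˢ Λ t) (sym (left t≤j)) (P₁ .coloured i≤t t≤j)
    ... | no t≰j = subst (_∈ˢ Λ t) (sym (right (ℕₚ.≰⇒> t≰j))) (P₂ .coloured (ℕₚ.≰⇒> t≰j) t≤n)
    joined′ : ∀ {t} → i ≤ t → t < n → Edge (σ t) (glue j ψ₁ ψ₂ t) (glue j ψ₁ ψ₂ (suc t))
    joined′ {t} i≤t t<n with ℕₚ.<-cmp t j
    ... | tri< t<j _ _ = subst₂ (Edge (σ t)) (sym (left (ℕₚ.<⇒≤ t<j))) (sym (left t<j)) (P₁ .joined i≤t t<j)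
    ... | tri≈ _ refl _ = subst₂ (Edge (σ t)) (sym (left ℕₚ.≤-refl)) (sym (right ℕₚ.≤-refl)) link
    ... | tri> _ _ j<t = subst₂ (Edge (σ t)) (sym (right j<t)) (sym (right (ℕₚ.m<n⇒m<1+n j<t))) (P₂ .joined j<t t<n)

  snoc : ∀ {i n ψ c} → ProperOn i n ψ → c ∈ˢ Λ (suc n) → Edge (σ n) (ψ n) c →
    ProperOn i (suc n) (glue n ψ (λ _ → c))
  snoc P c∈ link = glue-proper P (single c∈) link

  triple-proper : ∀ {a b c} → a ∈ˢ Λ 0 → b ∈ˢ Λ 1 → c ∈ˢ Λ 2 → Edge (σ 0) a b → Edge (σ 1) b c →
    ProperOn 0 2 (triple a b c)
  triple-proper a∈ b∈ c∈ ab bc .coloured {zero} _ _ = a∈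
  triple-proper a∈ b∈ c∈ ab bc .coloured {suc zero} _ _ = b∈
  triple-proper a∈ b∈ c∈ ab bc .coloured {suc (suc zero)} _ _ = c∈
  triple-proper a∈ b∈ c∈ ab bc .coloured {suc (suc (suc _))} _ (s≤s (s≤s ()))
  triple-proper a∈ b∈ c∈ ab bc .joined {zero} _ _ = ab
  triple-proper a∈ b∈ c∈ ab bc .joined {suc zero} _ _ = bc
  triple-proper a∈ b∈ c∈ ab bc .joined {suc (suc _)} _ (s≤s (s≤s ()))

  walk-to-any-colour : ∀ i m →
    (∀ j → j ≤ m → ContainsNeighbored (Λ (i + j * 2))) →
    (∀ j → j < m → ContainsAllBut (Λ (suc (i + j * 2)))) →
    ∀ {e} → e ∈ˢ Λ (i + m * 2) → ∃[ ψ ] ProperOn i (i + m * 2) ψ × ψ (i + m * 2) ≡ e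
  walk-to-any-colour i zero _ _ {e} e∈ =
    (λ _ → e) , subst (λ n → ProperOn i n (λ _ → e)) (sym (ℕₚ.+-identityʳ i))
                  (single (subst (λ n → e ∈ˢ Λ n) (ℕₚ.+-identityʳ i) e∈)) , refl
  walk-to-any-colour i (suc m) neighbored⊆ allBut⊆ {e} e∈
    with allBut⊆ m ℕₚ.≤-refl | neighbored⊆ m (ℕₚ.n≤1+n m)
  ... | q , ⊆allBut | s , x , ⊆neighbored
    with reached-from-neighbored e q s x (σ (suc (i + m * 2))) (σ (i + m * 2))
  ... | d , d∈ , de , h , h∈ , hd
    with walk-to-any-colour i m (λ j j≤m → neighbored⊆ j (ℕₚ.m≤n⇒m≤1+n j≤m))
           (λ j j<m → allBut⊆ j (ℕₚ.m<n⇒m<1+n j<m)) (⊆neighbored h h∈)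
  ... | ψ , P , ψn≡h =
    subst (λ top → ∃[ ψ ] ProperOn i top ψ × ψ top ≡ e) (sym two-more)
      (glue (suc n) (glue n ψ (λ _ → d)) (λ _ → e) ,
       snoc (snoc P (⊆allBut d d∈) (subst (λ h′ → Edge (σ n) h′ d) (sym ψn≡h) hd))
            (subst (λ t → e ∈ˢ Λ t) two-more e∈)
            (subst (λ d′ → Edge (σ (suc n)) d′ e) (sym (glue-top n ψ d)) de) ,
       glue-top (suc n) (glue n ψ (λ _ → d)) e)
    where
    n : ℕ
    n = i + m * 2
    two-more : i + suc m * 2 ≡ suc (suc n)
    two-more = trans (ℕₚ.+-suc i (suc (m * 2))) (cong suc (ℕₚ.+-suc i (m * 2)))

  CycleColouring : ℕ → (ℕ → C) → Set
  CycleColouring n ψ = ProperOn 0 n ψ × Edge (σ n) (ψ n) (ψ 0)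

  triangle-cycle : ∀ {A B D} → A ⊆ˢ Λ 0 → B ⊆ˢ Λ 1 → D ⊆ˢ Λ 2 → Triangle A B D (σ 0) (σ 1) (σ 2) →
    ∃[ ψ ] CycleColouring 2 ψ
  triangle-cycle ⊆₀ ⊆₁ ⊆₂ (a , a∈ , b , b∈ , ab , c , c∈ , bc , ca) =
    triple a b c , triple-proper (⊆₀ a a∈) (⊆₁ b b∈) (⊆₂ c c∈) ab bc , ca

  JoinedBelow : ℕ → C → C → Set
  JoinedBelow n d f = ∃₂ λ a b → ∃[ c ] a ∈ˢ Λ 0 × b ∈ˢ Λ 1 × c ∈ˢ Λ 2 ×
    Edge (σ n) d a × Edge (σ 0) a b × Edge (σ 1) b c × Edge (σ 2) c f

  Closable : ℕ → Set
  Closable m = ∃₂ λ d e → d ∈ˢ Λ (suc m) × e ∈ˢ Λ m × Edge (σ m) e d × ∀ f → JoinedBelow (suc m) d f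

  closable-cycle : ∀ m →
    (∀ j → j ≤ m → ContainsNeighbored (Λ (3 + j * 2))) →
    (∀ j → j < m → ContainsAllBut (Λ (4 + j * 2))) →
    Closable (3 + m * 2) → ∃[ ψ ] CycleColouring (4 + m * 2) ψ
  closable-cycle m neighbored⊆ allBut⊆ (d , e , d∈ , e∈ , ed , joined-below)
    with walk-to-any-colour 3 m neighbored⊆ allBut⊆ e∈
  ... | ψ , P , ψtop≡e with joined-below (ψ 3)
  ... | a , b , c , a∈ , b∈ , c∈ , da , ab , bc , cf =
    glue top ψ′ (λ _ → d) , snoc (glue-proper (triple-proper a∈ b∈ c∈ ab bc) P cf) d∈ top-link ,
    subst₂ (Edge (σ (suc top))) (sym (glue-top top ψ′ d)) (sym bottom) da
    where
    top : ℕ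
    top = 3 + m * 2
    ψ′ : ℕ → C
    ψ′ = glue 2 (triple a b c) ψ
    top-link : Edge (σ top) (ψ′ top) d
    top-link = subst (λ v → Edge (σ top) v d) (sym (trans (glue-> {2} {triple a b c} {ψ} (s≤s (s≤s (s≤s z≤n)))) ψtop≡e)) ed
    bottom : glue top ψ′ (λ _ → d) 0 ≡ a
    bottom = trans (glue-≤ {top} {ψ′} {λ _ → d} z≤n) (glue-≤ {2} {triple a b c} {ψ} z≤n)

  joined-below : ∀ {A s x l q₂ d f} n → A ⊆ˢ Λ 0 → neighbored s x ⊆ˢ Λ 1 → allBut q₂ ⊆ˢ Λ 2 →
    pairSet (l , s) ⊆ˢ neighbored s x → BridgedPart s x l q₂ (σ 1) (σ 2) f →
    ReachesBothParts A s x l (σ 0) (σ n) d → JoinedBelow n d f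
  joined-below n ⊆₀ ⊆₁ ⊆₂ part⊆ (inj₁ bridged) ((b , b∈ , a , a∈ , da , ab) , _) =
    let (c , c∈ , bc , cf) = bridged b b∈
    in a , b , c , ⊆₀ a a∈ , ⊆₁ b (part⊆ b b∈) , ⊆₂ c c∈ , da , ab , bc , cf
  joined-below n ⊆₀ ⊆₁ ⊆₂ part⊆ (inj₂ bridged) (_ , (b , b∈ , b∉ , a , a∈ , da , ab)) =
    let (c , c∈ , bc , cf) = bridged b b∈ b∉
    in a , b , c , ⊆₀ a a∈ , ⊆₁ b b∈ , ⊆₂ c c∈ , da , ab , bc , cf

  closable-allBut : ∀ m → ContainsAllBut (Λ 0) → ContainsNeighbored (Λ 1) → ContainsAllBut (Λ 2) →
    ContainsNeighbored (Λ m) → ContainsAllBut (Λ (suc m)) → Closable m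
  closable-allBut m (q₀ , ⊆₀) (s , x , ⊆₁) (q₂ , ⊆₂) (s′ , x′ , ⊆m) (q , ⊆top) =
    let (l , part⊆ , bridged) = some-part-always-bridged s x q₂ (σ 1) (σ 2)
        (q₁ , q₁′ , reaching) = reaching-both-parts-from-allBut s x l q₀ (σ 0) (σ (suc m)) part⊆
        (d , d∈ , d∉₁ , d∉₁′ , e , e∈ , ed) = allBut-avoiding-two-pairs q₁ q₁′ q s′ x′ (σ m)
    in d , e , ⊆top d d∈ , ⊆m e e∈ , ed , λ f →
       joined-below (suc m) ⊆₀ ⊆₁ ⊆₂ part⊆ (bridged f)
         (∈-tabulated-does (reachesBothParts? (allBut q₀) s x l (σ 0) (σ (suc m))) (reaching d d∉₁ d∉₁′))

  closable-full : ∀ m → full ⊆ˢ Λ 0 → ContainsNeighbored (Λ 1) → ContainsAllBut (Λ 2) →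
    ContainsNeighbored (Λ m) → ContainsNeighbored (Λ (suc m)) → Closable m
  closable-full m ⊆₀ (s , x , ⊆₁) (q₂ , ⊆₂) (s′ , x′ , ⊆m) (s″ , x″ , ⊆top) =
    let (l , part⊆ , bridged) = some-part-always-bridged s x q₂ (σ 1) (σ 2)
        (q₁ , reaching) = reaching-both-parts-from-full s x l (σ 0) (σ (suc m)) part⊆
        (d , d∈ , d∉₁ , e , e∈ , ed) = neighbored-avoiding-a-pair q₁ s″ x″ s′ x′ (σ m)
    in d , e , ⊆top d d∈ , ⊆m e e∈ , ed , λ f →
       joined-below (suc m) ⊆₀ ⊆₁ ⊆₂ part⊆ (bridged f)
         (∈-tabulated-does (reachesBothParts? full s x l (σ 0) (σ (suc m))) (reaching d d∉₁))

  cycle-allBut : ∀ k → 1 ≤ k →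
    (∀ j → j < k → ContainsNeighbored (Λ (suc (j * 2)))) →
    (∀ j → j ≤ k → ContainsAllBut (Λ (j * 2))) →
    ∃[ ψ ] CycleColouring (k * 2) ψ
  cycle-allBut (suc zero) _ neighbored⊆ allBut⊆
    with allBut⊆ 0 z≤n | neighbored⊆ 0 (s≤s z≤n) | allBut⊆ 1 ℕₚ.≤-refl
  ... | q₀ , ⊆₀ | s , x , ⊆₁ | q₂ , ⊆₂ =
    triangle-cycle ⊆₀ ⊆₁ ⊆₂ (triangle-allBut q₀ s x q₂ (σ 0) (σ 1) (σ 2))
  cycle-allBut (suc (suc m)) _ neighbored⊆ allBut⊆ =
    closable-cycle m (λ j j≤m → neighbored⊆ (suc j) (s≤s (s≤s j≤m)))
      (λ j j<m → allBut⊆ (suc (suc j)) (s≤s (s≤s (ℕₚ.<⇒≤ j<m))))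
      (closable-allBut (3 + m * 2) (allBut⊆ 0 z≤n) (neighbored⊆ 0 (s≤s z≤n)) (allBut⊆ 1 (s≤s z≤n))
        (neighbored⊆ (suc m) ℕₚ.≤-refl) (allBut⊆ (suc (suc m)) ℕₚ.≤-refl))

  cycle-full : ∀ k → 1 ≤ k → full ⊆ˢ Λ 0 →
    (∀ j → j < k → ContainsNeighbored (Λ (suc (j * 2)))) →
    (∀ j → 1 ≤ j → j < k → ContainsAllBut (Λ (j * 2))) →
    ContainsNeighbored (Λ (k * 2)) →
    ∃[ ψ ] CycleColouring (k * 2) ψ
  cycle-full (suc zero) _ ⊆₀ neighbored⊆ _ (s′ , x′ , ⊆₂) with neighbored⊆ 0 (s≤s z≤n)
  ... | s , x , ⊆₁ = triangle-cycle ⊆₀ ⊆₁ ⊆₂ (triangle-full s x s′ x′ (σ 0) (σ 1) (σ 2))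
  cycle-full (suc (suc m)) _ ⊆₀ neighbored⊆ allBut⊆ last =
    closable-cycle m (λ j j≤m → neighbored⊆ (suc j) (s≤s (s≤s j≤m)))
      (λ j j<m → allBut⊆ (suc (suc j)) (s≤s z≤n) (s≤s (s≤s j<m)))
      (closable-full (3 + m * 2) ⊆₀ (neighbored⊆ 0 (s≤s z≤n)) (allBut⊆ 1 ℕₚ.≤-refl (s≤s (s≤s z≤n)))
        (neighbored⊆ (suc m) ℕₚ.≤-refl) last)

-- The cycle C_{2k+1}

module OnCycle {k : ℕ} (σ : Signature k) (L : ListAssignment k) where

  vertex : ℕ → Cyc k
  vertex t = t mod suc (2 * k)

  open Walks (λ t → L (vertex t)) (λ t → σ (vertex t)) public

  toℕ-vertex : ∀ {t} → t ≤ k * 2 → toℕ (vertex t) ≡ t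
  toℕ-vertex {t} t≤ = trans (Finₚ.toℕ-fromℕ< _) (m<n⇒m%n≡m (s≤s (subst (t ≤_) (ℕₚ.*-comm k 2) t≤)))

  vertex-toℕ : ∀ i → vertex (toℕ i) ≡ i
  vertex-toℕ i = Finₚ.toℕ-injective (trans (Finₚ.toℕ-fromℕ< _) (m<n⇒m%n≡m (Finₚ.toℕ<n i)))

  toℕ≤top : ∀ (i : Cyc k) → toℕ i ≤ k * 2
  toℕ≤top i = subst (toℕ i ≤_) (ℕₚ.*-comm 2 k) (ℕₚ.≤-pred (Finₚ.toℕ<n i))

  colouring : ∃[ ψ ] CycleColouring (k * 2) ψ → LColorable k σ L
  colouring (ψ , P , closing) = (λ i → ψ (toℕ i)) , coloured , joined
    where
    coloured : ∀ i → ψ (toℕ i) ∈ˢ L i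
    coloured i = subst (λ v → ψ (toℕ i) ∈ˢ L v) (vertex-toℕ i) (ProperOn.coloured P z≤n (toℕ≤top i))
    around : ∀ i → Edge (σ i) (ψ (toℕ i)) (ψ (toℕ (next k i)))
    around i with ℕₚ.m≤n⇒m<n∨m≡n (toℕ≤top i)
    ... | inj₁ i<top =
      subst₂ (λ v t → Edge (σ v) (ψ (toℕ i)) (ψ t)) (vertex-toℕ i) (sym (toℕ-vertex i<top))
        (ProperOn.joined P z≤n i<top)
    ... | inj₂ i≡top =
      subst₂ (λ v t → Edge (σ v) (ψ (toℕ i)) (ψ t)) (vertex-toℕ i) (sym wraps)
        (subst (λ t → Edge (σ (vertex t)) (ψ t) (ψ 0)) (sym i≡top) closing)
      where
      wraps : toℕ (next k i) ≡ 0
      wraps = trans (Finₚ.toℕ-fromℕ< _)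
        (trans (cong (λ t → suc t % suc (2 * k)) (trans i≡top (ℕₚ.*-comm k 2))) (n%n≡0 (suc (2 * k))))
    joined : ∀ i → Adjacent (ψ (toℕ i)) (ψ (toℕ (next k i))) × mstar (ψ (toℕ i)) (ψ (toℕ (next k i))) ≡ σ i
    joined i = Edge.adjacent (around i) , Edge.signed (around i)

  pos-vertex : ∀ {t} → t ≤ k * 2 → pos k (vertex t) ≡ suc t
  pos-vertex t≤ = cong suc (toℕ-vertex t≤)

  odd-index : ∀ {j} → j < k → suc (j * 2) ≤ k * 2
  odd-index j<k = ℕₚ.≤-trans (ℕₚ.n≤1+n _) (ℕₚ.*-monoˡ-≤ 2 j<k)

  even-pos : ∀ {j} → j < k → EvenN (pos k (vertex (suc (j * 2))))
  even-pos {j} j<k = subst (λ p → p % 2 ≡ 0) (sym (pos-vertex (odd-index j<k))) (m*n%n≡0 (suc j) 2)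

  odd-pos : ∀ {j} → j ≤ k → OddN (pos k (vertex (j * 2)))
  odd-pos {j} j≤k = subst (λ p → p % 2 ≡ 1) (sym (pos-vertex (ℕₚ.*-monoˡ-≤ 2 j≤k))) ([m+kn]%n≡m%n 1 j 2)

  interior : ∀ {t} → 1 ≤ t → t < k * 2 → 1 < pos k (vertex t) × pos k (vertex t) < suc (2 * k)
  interior {t} 1≤t t<top rewrite toℕ-vertex (ℕₚ.<⇒≤ t<top) =
    s≤s 1≤t , s≤s (subst (t <_) (ℕₚ.*-comm k 2) t<top)

  neighbored-at₁ : Cond1 k L → ∀ j → j < k → ContainsNeighbored (L (vertex (suc (j * 2))))
  neighbored-at₁ cond j j<k = neighbored5-contains-neighbored (proj₁ (cond (vertex (suc (j * 2)))) (even-pos j<k))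

  allBut-at₁ : Cond1 k L → ∀ j → j ≤ k → ContainsAllBut (L (vertex (j * 2)))
  allBut-at₁ cond j j≤k = paired10-contains-allBut (proj₂ (cond (vertex (j * 2))) (odd-pos j≤k))

  full-at-first : Cond2 k L → full ⊆ˢ L (vertex 0)
  full-at-first (first∈ , _) c _ = first∈ c

  neighbored-at₂ : Cond2 k L → ∀ j → j < k → ContainsNeighbored (L (vertex (suc (j * 2))))
  neighbored-at₂ (_ , _ , middle) j j<k =
    let (1<pos , pos<) = interior (s≤s z≤n) (ℕₚ.*-monoˡ-≤ 2 j<k)
    in neighbored5-contains-neighbored (proj₁ (middle (vertex (suc (j * 2))) 1<pos pos<) (even-pos j<k))

  allBut-at₂ : Cond2 k L → ∀ j → 1 ≤ j → j < k → ContainsAllBut (L (vertex (j * 2)))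
  allBut-at₂ (_ , _ , middle) (suc j) _ j<k =
    let (1<pos , pos<) = interior (s≤s z≤n) (ℕₚ.≤-trans (ℕₚ.n≤1+n _) (ℕₚ.*-monoˡ-≤ 2 j<k))
    in paired10-contains-allBut (proj₂ (middle (vertex (suc j * 2)) 1<pos pos<) (odd-pos (ℕₚ.<⇒≤ j<k)))

  neighbored-at-last : Cond2 k L → ContainsNeighbored (L (vertex (k * 2)))
  neighbored-at-last (_ , last , _) = neighbored5-contains-neighbored (subst (λ v → Neighbored5 (L v)) (sym is-last) last)
    where
    is-last : vertex (k * 2) ≡ lastV k
    is-last = Finₚ.toℕ-injective (trans (toℕ-vertex ℕₚ.≤-refl) (trans (ℕₚ.*-comm k 2) (sym (Finₚ.toℕ-fromℕ (2 * k)))))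

lemma4p11 : (k : ℕ) → 1 ≤ k → (σ : Signature k) → (L : ListAssignment k) →
    Cond1 k L ⊎ Cond2 k L → LColorable k σ L
lemma4p11 k 1≤k σ L (inj₁ cond) =
  colouring (cycle-allBut k 1≤k (neighbored-at₁ cond) (allBut-at₁ cond))
  where open OnCycle {k} σ L
lemma4p11 k 1≤k σ L (inj₂ cond) =
  colouring (cycle-full k 1≤k (full-at-first cond) (neighbored-at₂ cond) (allBut-at₂ cond) (neighbored-at-last cond))
  where open OnCycle {k} σ L
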